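{- Let $\mathfrak{C}_o\subseteq\mathfrak{U}'\subseteq\mathfrak{U}$, let $R\in\mathfrak{U}$, and let $\mathcal{E}(R)$ be the EV-system of $R$ with respect to $\mathfrak{U}'$. Then for all $\mathfrak{a},\mathfrak{b}\in\mathcal{E}_o(R)$: - $\{\mathfrak{a},\mathfrak{b}\}$ is a proper edge of $\mathcal{E}(R)$ (i.e. an edge of $\mathcal{E}(R)^*$) iff $\mathfrak{a}_1\in\mathfrak{b}_2$ and $\mathfrak{b}_1\in\mathfrak{a}_2$; - $\{\mathfrak{a}\}\in A(\mathcal{E}(R))$ iff $\{\mathfrak{a}_1\}\in A(R)$. Moreover, ERD and AID hold if $\mathfrak{U}'=\mathfrak{U}$, and they also hold if $R\in\mathfrak{C}_o$.
   Context: An undirected graph $G$ has a finite nonempty vertex set $V(G)$ and an edge set $A(G)$ of 1-element subsets (loops) and 2-element subsets (proper edges) of $V(G)$. $G^*$ is $G$ with loops removed. $N_G(v)=\{w\ne v:\{v,w\}\in A(G)\}$. A homomorphism maps edges to edges; it is strict if, in addition, it maps proper edges to proper edges. $\mathcal{S}_u(G,H)$ is the set of strict homomorphisms. Classes of graphs: $\mathfrak{U}$ is a representative system of the isomorphism classes of finite undirected graphs (constructed graphs are identified with their representatives). $\mathfrak{C}_o=\{G\in\mathfrak{U}:G^*\text{ contains no cycle of odd length}\}$. EV-system of $R$ with respect to $\mathfrak{U}'$: - Vertex set $\mathcal{E}_o(R)=\{(v,D):v\in V(R),D\subseteq N_R(v)\}$, with components $\mathfrak{a}_1,\mathfrak{a}_2$.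 - $\phi_R(\mathfrak{a})=\mathfrak{a}_1$. - $\alpha^R_{G,\xi}(v)=(\xi(v),\xi[N_G(v)])$ for $G\in\mathfrak{U}'$ and $\xi\in\mathcal{S}_u(G,R)$. - $\{\mathfrak{a},\mathfrak{b}\}$ ($\mathfrak{a}=\mathfrak{b}$ allowed) is an edge iff there exist $G\in\mathfrak{U}'$, $\xi\in\mathcal{S}_u(G,R)$ and $\{v,w\}\in A(G)$ ($v=w$ allowed) with $\mathfrak{a}=\alpha^R_{G,\xi}(v)$ and $\mathfrak{b}=\alpha^R_{G,\xi}(w)$. ERD means $\mathcal{E}(R)\in\mathfrak{U}'$. AID means that ERD holds and $\alpha^R_{\mathcal{E}(R),\phi_R}$ is the identity of $\mathcal{E}_o(R)$. -}

module Defs where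

open import Data.Nat using (ℕ; zero; suc; _+_; _*_)
open import Data.Bool using (Bool; true; false; T; _∧_; not)
open import Data.Fin using (Fin; zero; suc; inject₁; fromℕ; _≟_)
open import Data.Fin.Properties using (any?)
open import Data.Fin.Subset using (Subset; _∈_; _⊆_)
open import Data.Fin.Subset.Properties using (_∈?_; _⊆?_)
open import Data.Vec using (tabulate)
open import Data.Product using (Σ; Σ-syntax; _×_; _,_; proj₁; proj₂)
open import Relation.Nullary using (¬_; Dec; yes; no)
open import Relation.Nullary.Decidable using (⌊_⌋; True; _×-dec_)
open import Relation.Binary.PropositionalEquality using (_≡_; _≢_)
open import Function using (_∘_; _⇔_)
open import Function.Bundles using (_↔_; Inverse)
open import Function.Definitions using (Injective)

-- A finite undirected graph (loops allowed) on vertex set Fin (suc n)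
-- (finite and nonempty).  adj v w = true  iff  {v,w} ∈ A(G)
-- (for v = w this is the loop {v}).
record Graph : Set where
  field
    n   : ℕ
    adj : Fin (suc n) → Fin (suc n) → Bool
    sym : ∀ v w → adj v w ≡ adj w v
open Graph public

V : Graph → Set
V G = Fin (suc (n G))

Edge : (G : Graph) → V G → V G → Set
Edge G v w = T (adj G v w)

N : (G : Graph) → V G → Subset (suc (n G))
N G v = tabulate (λ w → adj G v w ∧ not ⌊ v ≟ w ⌋)

_≅_ : Graph → Graph → Set
G ≅ H = Σ[ f ∈ V G ↔ V H ] (∀ v w → adj G v w ≡ adj H (Inverse.to f v) (Inverse.to f w))

IsStrictHom : (G H : Graph) → (V G → V H) → Set
IsStrictHom G H ξ =
  (∀ v w → Edge G v w → Edge H (ξ v) (ξ w)) ×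
  (∀ v w → v ≢ w → Edge G v w → ξ v ≢ ξ w)

-- G* contains a cycle of odd length 2m+3 (vertices c 0, ..., c (2m+2), pairwise
-- distinct, consecutive ones adjacent, and c (2m+2) adjacent to c 0).
OddCycle : Graph → Set
OddCycle G =
  Σ[ m ∈ ℕ ] Σ[ c ∈ (Fin (suc (2 + 2 * m)) → V G) ]
    (Injective _≡_ _≡_ c ×
     (∀ (i : Fin (2 + 2 * m)) → Edge G (c (inject₁ i)) (c (suc i))) ×
     Edge G (c (fromℕ (2 + 2 * m))) (c zero))

InCo : Graph → Set
InCo G = ¬ OddCycle G

IsoInvariant : (Graph → Set) → Set
IsoInvariant P = ∀ G H → G ≅ H → P G → P H

EVo : Graph → Set
EVo R = Σ[ v ∈ V R ] Σ[ D ∈ Subset (suc (n R)) ] True (D ⊆? N R v)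

fst₁ : (R : Graph) → EVo R → V R
fst₁ R 𝔞 = proj₁ 𝔞

snd₂ : (R : Graph) → EVo R → Subset (suc (n R))
snd₂ R 𝔞 = proj₁ (proj₂ 𝔞)

φ : (R : Graph) → EVo R → V R
φ R 𝔞 = fst₁ R 𝔞

img : (G R : Graph) → (V G → V R) → Subset (suc (n G)) → Subset (suc (n R))
img G R ξ S = tabulate (λ w → ⌊ any? (λ u → (u ∈? S) ×-dec (ξ u ≟ w)) ⌋)

αpair : (G R : Graph) → (V G → V R) → V G → V R × Subset (suc (n R))
αpair G R ξ v = ξ v , img G R ξ (N G v)

-- the components of an element of 𝓔_o(R); the third component of EVo is a
-- proof of the (decidable) condition D ⊆ N_R(v), which is proof-irrelevant,
-- so 𝔞 = α(v) is expressed as equality of components.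
comps : (R : Graph) → EVo R → V R × Subset (suc (n R))
comps R 𝔞 = fst₁ R 𝔞 , snd₂ R 𝔞

-- edge relation of 𝓔(R) w.r.t. the class 𝔘' (given by P)
EVEdge : (P : Graph → Set) (R : Graph) → EVo R → EVo R → Set
EVEdge P R 𝔞 𝔟 =
  Σ[ G ∈ Graph ] (P G × Σ[ ξ ∈ (V G → V R) ] (IsStrictHom G R ξ ×
    Σ[ v ∈ V G ] Σ[ w ∈ V G ] (Edge G v w ×
      comps R 𝔞 ≡ αpair G R ξ v × comps R 𝔟 ≡ αpair G R ξ w)))

-- A representative H of 𝓔(R) lying in 𝔘': an isomorphism of H onto 𝓔(R)
record ERDWitness (P : Graph → Set) (R : Graph) : Set where
  field
    H     : Graph
    inU'  : P H
    iso   : V H ↔ EVo R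
    edges : ∀ x y → Edge H x y ⇔ EVEdge P R (Inverse.to iso x) (Inverse.to iso y)

ERD : (P : Graph → Set) → Graph → Set
ERD P R = ERDWitness P R

-- AID: ERD holds and α^R_{𝓔(R),φ_R} is the identity of 𝓔_o(R)
-- (𝓔(R) identified with its representative H via iso).
AID : (P : Graph → Set) → Graph → Set
AID P R = Σ[ e ∈ ERDWitness P R ]
  (let open ERDWitness e
       ξ = φ R ∘ Inverse.to iso
   in IsStrictHom H R ξ × (∀ x → αpair H R ξ x ≡ comps R (Inverse.to iso x)))

-- If a₁ ∈ b₂ and
-- b₁ ∈ a₂, take two adjacent vertices mapped to a₁ and b₁ and give each of them pendant
-- neighbours realising the rest of a₂ and b₂; for a loop take one looped vertex with
-- pendant neighbours realising a₂.  These test graphs are bipartite, hence in 𝔉_o ⊆ 𝔘'.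
-- Conversely a strict homomorphism sends an edge vw to a₁ ∈ ξ[N(w)] and b₁ ∈ ξ[N(v)].
-- So 𝓔(R) is an explicit finite graph H, on which φ_R is a strict homomorphism whose
-- α-map is the identity: b ∈ a₂ is realised by the neighbour (b, {a₁}) of (a₁, a₂).
-- H lies in 𝔘' when 𝔘' = 𝔘, and also when R ∈ 𝔉_o: a strict homomorphism maps an odd
-- cycle to an odd closed walk, and a shortest odd closed walk is an odd cycle.
module Submission where

open import Defs
open import Data.Fin.Subset using (_∈_)
open import Data.Product using (_×_)
open import Relation.Binary.PropositionalEquality using (_≢_)
open import Function using (_⇔_)

open import Data.Bool using (Bool; true; false; T; not; _∧_)
import Data.Bool as Bool
open import Data.Bool.Properties using (T?; T-≡; T-∧; T-irrelevant; ∧-comm)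
open import Data.Empty using (⊥-elim)
open import Data.Fin using (Fin; zero; suc; _≟_; splitAt; join; toℕ; fromℕ; fromℕ<; inject₁)
open import Data.Fin.Properties
  using (any?; splitAt-join; join-splitAt; toℕ-injective; toℕ<n; fromℕ<-toℕ; toℕ-fromℕ<;
         toℕ-inject₁; toℕ-fromℕ)
open import Data.Fin.Subset using (Subset; _⊆_; _∉_; _∩_; ⊥; ⁅_⁆)
open import Data.Fin.Subset.Properties
  using (_∈?_; x∈⁅x⁆; x∈⁅y⁆⇒x≡y; ⊆-antisym; ∉⊥; p∩q⊆p; p∩q⊆q; x∈p∩q⁺)
open import Data.List as List using (List; []; _∷_; deduplicate; cartesianProductWith)
open import Data.List.Membership.Propositional using () renaming (_∈_ to _∈ₗ_)
open import Data.List.Membership.Propositional.Properties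
  using (∈-lookup; ∈-deduplicate⁺; ∈-cartesianProductWith⁺; ∈-allFin)
open import Data.List.Relation.Unary.Any using (here; there; index)
open import Data.List.Relation.Unary.Any.Properties using (lookup-index)
open import Data.List.Relation.Unary.Unique.Propositional using (Unique; _∷_)
open import Data.List.Relation.Unary.Unique.Propositional.Properties using (Unique[x∷xs]⇒x∉xs)
open import Data.List.Relation.Unary.Unique.DecPropositional.Properties using (deduplicate-!)
open import Data.Nat using (ℕ; zero; suc; pred; _+_; _*_; _∸_; _<_; _≤_; _≮_; z≤n; z<s; s≤s⁻¹; parity)
open import Data.Nat.Induction using (<-rec)
open import Data.Nat.Properties
  using (≤-refl; ≤-trans; <-trans; <-≤-trans; ≤-<-trans; <⇒≤; <⇒≱; ≤-antisym; ≮⇒≥; <-cmp;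
         _<?_; _≤?_; anyUpTo?; n≮n; 1+n≢n; +-suc; +-identityʳ; +-monoʳ-<; +-monoˡ-≤;
         m≤m+n; m≤n+m; m<n⇒m<1+n; m+n≤o⇒m≤o∸n; m∸n+n≡m; m∸n≤m; m+[n∸m]≡n; ∸-monoʳ-<;
         m<n⇒0<n∸m)
open import Data.Parity using (Parity; 0ℙ; 1ℙ; _⁻¹)
import Data.Parity as ℙ
import Data.Parity.Properties as ℙₚ
open import Data.Product using (Σ-syntax; ∃-syntax; _,_; proj₁; proj₂)
import Data.Product.Properties as Product
open import Data.Sum using (_⊎_; inj₁; inj₂; reduce; [_,_]′)
open import Data.Unit using (tt)
open import Data.Vec using ([]; _∷_; tabulate)
import Data.Vec.Properties as Vec
open import Data.Vec.Properties using (lookup∘tabulate; []=⇒lookup; lookup⇒[]=)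
open import Function using (_∘_; const; Equivalence; mk⇔)
open import Function.Bundles using (_↔_; mk↔ₛ′; Inverse; Injection)
open import Function.Construct.Composition using (_⇔-∘_)
open import Function.Construct.Symmetry using (⇔-sym)
open import Function.Definitions using (Injective)
open import Function.Properties.Inverse using (↔⇒↣)
open import Relation.Binary.Definitions using (tri<; tri≈; tri>; DecidableEquality)
open import Relation.Binary.PropositionalEquality as ≡
  using (_≡_; refl; trans; cong; cong₂; subst; subst₂)
open import Relation.Nullary using (¬_; Dec; yes; no; contradiction)
open import Relation.Nullary.Decidable
  using (⌊_⌋; isYes≗does; does-⇔; map′; _×-dec_; _⊎-dec_; toWitness; fromWitness;
         toWitnessFalse; fromWitnessFalse)

open Equivalence

∈-tabulate : ∀ {m} (f : Fin m → Bool) {x} → x ∈ tabulate f ⇔ T (f x)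
∈-tabulate f {x} = mk⇔
  (λ x∈ → subst T (lookup∘tabulate f x) (from T-≡ ([]=⇒lookup x∈)))
  (λ fx → lookup⇒[]= x (tabulate f) (trans (lookup∘tabulate f x) (to T-≡ fx)))

Edge-sym : ∀ G {v w} → Edge G v w → Edge G w v
Edge-sym G {v} {w} = subst T (Graph.sym G v w)

∈-N : ∀ G {v x} → x ∈ N G v ⇔ (Edge G v x × v ≢ x)
∈-N G {v} {x} = mk⇔
  (λ x∈ → let (e , ne) = to T-∧ (to (∈-tabulate adjacentNotEqual) x∈) in e , toWitnessFalse ne)
  (λ (e , ne) → from (∈-tabulate adjacentNotEqual) (from T-∧ (e , fromWitnessFalse ne)))
  where adjacentNotEqual = λ w → adj G v w ∧ not ⌊ v ≟ w ⌋

∈-N-sym : ∀ G {v x} → x ∈ N G v → v ∈ N G x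
∈-N-sym G x∈ = let (e , ne) = to (∈-N G) x∈ in from (∈-N G) (Edge-sym G e , ne ∘ ≡.sym)

∈-img : ∀ G R {ξ : V G → V R} {S r} → r ∈ img G R ξ S ⇔ (∃[ u ] u ∈ S × ξ u ≡ r)
∈-img G R {ξ} {S} = mk⇔ (toWitness ∘ to (∈-tabulate hitBy)) (from (∈-tabulate hitBy) ∘ fromWitness)
  where hitBy = λ w → ⌊ any? (λ u → (u ∈? S) ×-dec (ξ u ≟ w)) ⌋

img-N-≡ : ∀ G R (ξ : V G → V R) x {D} →
          (∀ {u} → u ∈ N G x → ξ u ∈ D) →
          (∀ {r} → r ∈ D → ∃[ u ] u ∈ N G x × ξ u ≡ r) →
          img G R ξ (N G x) ≡ D
img-N-≡ G R ξ x img⊆ ⊆img = ⊆-antisym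
  (λ r∈ → let (u , u∈ , ξu) = to (∈-img G R) r∈ in subst (_∈ _) ξu (img⊆ u∈))
  (from (∈-img G R) ∘ ⊆img)

-- Odd closed walks and odd cycles

parity-suc : ∀ n → parity (suc n) ≡ parity n ⁻¹
parity-suc n = ≡.sym (ℙₚ.⁻¹-selfInverse (ℙₚ.suc-homo-⁻¹ n))

parity-∸-even : ∀ {m n} → parity n ≡ 0ℙ → n ≤ m → parity (m ∸ n) ≡ parity m
parity-∸-even {m} {n} even-n n≤m = begin
  parity (m ∸ n)                   ≡⟨ ℙₚ.+-identityʳ (parity (m ∸ n)) ⟨
  parity (m ∸ n) ℙ.+ 0ℙ            ≡⟨ cong (parity (m ∸ n) ℙ.+_) even-n ⟨
  parity (m ∸ n) ℙ.+ parity n      ≡⟨ ℙₚ.+-homo-+ (m ∸ n) n ⟨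
  parity (m ∸ n + n)               ≡⟨ cong parity (m∸n+n≡m n≤m) ⟩
  parity m                         ∎
  where open ≡.≡-Reasoning

ProperEdge : (G : Graph) → V G → V G → Set
ProperEdge G x y = Edge G x y × x ≢ y

ProperEdge-sym : ∀ G {x y} → ProperEdge G x y → ProperEdge G y x
ProperEdge-sym G (e , x≢y) = Edge-sym G e , x≢y ∘ ≡.sym

strictHom-ProperEdge : ∀ {G H ξ} → IsStrictHom G H ξ →
                       ∀ {x y} → ProperEdge G x y → ProperEdge H (ξ x) (ξ y)
strictHom-ProperEdge (hom , strict) (e , x≢y) = hom _ _ e , strict _ _ x≢y e

record OddClosedWalk (G : Graph) : Set where
  field
    length : ℕ
    vertex : ℕ → V G
    odd    : parity length ≡ 1ℙ
    closed : vertex length ≡ vertex 0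
    step   : ∀ {k} → k < length → ProperEdge G (vertex k) (vertex (suc k))
open OddClosedWalk

OddClosedWalk-map : ∀ {G H ξ} → IsStrictHom G H ξ → OddClosedWalk G → OddClosedWalk H
OddClosedWalk-map {G} {H} {ξ} ξ-strict W = record
  { length = length W
  ; vertex = ξ ∘ vertex W
  ; odd    = odd W
  ; closed = cong ξ (closed W)
  ; step   = strictHom-ProperEdge {G} {H} ξ-strict ∘ step W
  }

ProperColouring : (G : Graph) → (V G → Parity) → Set
ProperColouring G col = ∀ {x y} → ProperEdge G x y → col x ≢ col y

module _ {G : Graph} {col : V G → Parity} (proper : ProperColouring G col) where

  colour-alternates : (W : OddClosedWalk G) → ∀ {k} → k ≤ length W →
                      col (vertex W k) ≡ col (vertex W 0) ℙ.+ parity k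
  colour-alternates W {zero} _ = ≡.sym (ℙₚ.+-identityʳ _)
  colour-alternates W {suc k} k<L = begin
    col (vertex W (suc k))                ≡⟨ ≢⇒≡⁻¹ (proper (step W k<L)) ⟩
    col (vertex W k) ⁻¹                   ≡⟨ cong _⁻¹ (colour-alternates W (<⇒≤ k<L)) ⟩
    (col (vertex W 0) ℙ.+ parity k) ⁻¹    ≡⟨ +-⁻¹ (col (vertex W 0)) (parity k) ⟩
    col (vertex W 0) ℙ.+ parity k ⁻¹      ≡⟨ cong (col (vertex W 0) ℙ.+_) (parity-suc k) ⟨
    col (vertex W 0) ℙ.+ parity (suc k)   ∎
    where
    open ≡.≡-Reasoning
    ≢⇒≡⁻¹ : ∀ {p q} → p ≢ q → q ≡ p ⁻¹
    ≢⇒≡⁻¹ {0ℙ} {0ℙ} p≢q = contradiction refl p≢q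
    ≢⇒≡⁻¹ {0ℙ} {1ℙ} _   = refl
    ≢⇒≡⁻¹ {1ℙ} {0ℙ} _   = refl
    ≢⇒≡⁻¹ {1ℙ} {1ℙ} p≢q = contradiction refl p≢q
    +-⁻¹ : ∀ p q → (p ℙ.+ q) ⁻¹ ≡ p ℙ.+ q ⁻¹
    +-⁻¹ 0ℙ q = refl
    +-⁻¹ 1ℙ q = refl

  properColouring⇒noOddClosedWalk : ¬ OddClosedWalk G
  properColouring⇒noOddClosedWalk W = ℙₚ.p≢p⁻¹ c₀ (begin
    c₀                                 ≡⟨ cong col (closed W) ⟨
    col (vertex W (length W))          ≡⟨ colour-alternates W ≤-refl ⟩
    c₀ ℙ.+ parity (length W)           ≡⟨ cong (c₀ ℙ.+_) (odd W) ⟩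
    c₀ ℙ.+ 1ℙ                          ≡⟨ ℙₚ.+-comm c₀ 1ℙ ⟩
    c₀ ⁻¹                              ∎)
    where
    open ≡.≡-Reasoning
    c₀ = col (vertex W 0)

OddCycle⇒OddClosedWalk : ∀ {G} → OddCycle G → OddClosedWalk G
OddCycle⇒OddClosedWalk {G} (m , c , c-injective , c-edges , c-last) = record
  { length = suc K
  ; vertex = vertex′
  ; odd    = trans (parity-suc (2 * m)) (cong _⁻¹ (ℙₚ.*-homo-* 2 m))
  ; closed = trans (vertex′-beyond (suc K) (n≮n (suc K))) (≡.sym (vertex′-toℕ zero))
  ; step   = step′
  }
  where
  K = 2 + 2 * m

  vertex′ : ℕ → V G
  vertex′ k with k <? suc K
  ... | yes k<  = c (fromℕ< k<)
  ... | no  _   = c zero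

  vertex′-toℕ : ∀ i → vertex′ (toℕ i) ≡ c i
  vertex′-toℕ i with toℕ i <? suc K
  ... | yes i< = cong c (fromℕ<-toℕ i i<)
  ... | no  i≮ = contradiction (toℕ<n i) i≮

  vertex′-beyond : ∀ k → k ≮ suc K → vertex′ k ≡ c zero
  vertex′-beyond k k≮ with k <? suc K
  ... | yes k< = contradiction k< k≮
  ... | no  _  = refl

  vertex′-≡ : ∀ {k i} → k ≡ toℕ i → vertex′ k ≡ c i
  vertex′-≡ {i = i} refl = vertex′-toℕ i

  cycleEdge : ∀ {i j} → Edge G (c i) (c j) → i ≢ j → ProperEdge G (c i) (c j)
  cycleEdge e i≢j = e , i≢j ∘ c-injective

  step′ : ∀ {k} → k < suc K → ProperEdge G (vertex′ k) (vertex′ (suc k))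
  step′ {k} k<1+K with k <? K
  ... | yes k<K = subst₂ (ProperEdge G)
                    (≡.sym (vertex′-≡ k≡i)) (≡.sym (vertex′-≡ (cong suc k≡i′)))
                    (cycleEdge (c-edges i) inject₁i≢suci)
    where
    i = fromℕ< k<K
    k≡i′ : k ≡ toℕ i
    k≡i′ = ≡.sym (toℕ-fromℕ< k<K)
    k≡i : k ≡ toℕ (inject₁ i)
    k≡i = trans k≡i′ (≡.sym (toℕ-inject₁ i))
    inject₁i≢suci : inject₁ i ≢ suc i
    inject₁i≢suci eq = 1+n≢n (≡.sym (trans (≡.sym (toℕ-inject₁ i)) (cong toℕ eq)))
  ... | no  k≮K = subst₂ (ProperEdge G) (≡.sym (vertex′-≡ k≡K))
                    (≡.sym (vertex′-beyond (suc k) (k≮K ∘ s≤s⁻¹)))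
                    (cycleEdge c-last λ ())
    where
    k≡K : k ≡ toℕ (fromℕ K)
    k≡K = trans (≤-antisym (s≤s⁻¹ k<1+K) (≮⇒≥ k≮K)) (≡.sym (toℕ-fromℕ K))

odd-cases : ∀ n → parity n ≡ 1ℙ → n ≡ 1 ⊎ ∃[ m ] n ≡ suc (2 + 2 * m)
odd-cases 1 _ = inj₁ refl
odd-cases (suc (suc n)) p with odd-cases n p
... | inj₁ refl       = inj₂ (0 , refl)
... | inj₂ (m , refl) = inj₂ (suc m , cong (λ k → 4 + k) (≡.sym (+-suc m (m + 0))))

module _ {G : Graph} where

  Repeat : OddClosedWalk G → Set
  Repeat W = ∃[ j ] j < length W × ∃[ i ] i < j × vertex W i ≡ vertex W j

  repeat? : (W : OddClosedWalk G) → Dec (Repeat W)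
  repeat? W = anyUpTo? (λ j → anyUpTo? (λ i → vertex W i ≟ vertex W j) j) (length W)

  noRepeat⇒OddCycle : (W : OddClosedWalk G) → ¬ Repeat W → OddCycle G
  noRepeat⇒OddCycle W no-repeat with odd-cases (length W) (odd W)
  ... | inj₁ L≡1 = contradiction (≡.sym (trans (cong (vertex W) (≡.sym L≡1)) (closed W)))
                     (proj₂ (step W (subst (0 <_) (≡.sym L≡1) z<s)))
  ... | inj₂ (m , L≡) = m , vertex W ∘ toℕ , injective , edges , last
    where
    K = 2 + 2 * m
    bound : ∀ {k} → k < suc K → k < length W
    bound = subst (_ <_) (≡.sym L≡)
    injective : Injective _≡_ _≡_ (vertex W ∘ toℕ)
    injective {x} {y} eq with <-cmp (toℕ x) (toℕ y)
    ... | tri< x<y _ _ = contradiction (toℕ y , bound (toℕ<n y) , toℕ x , x<y , eq) no-repeat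
    ... | tri≈ _ x≡y _ = toℕ-injective x≡y
    ... | tri> _ _ y<x = contradiction (toℕ x , bound (toℕ<n x) , toℕ y , y<x , ≡.sym eq) no-repeat
    edges : ∀ i → Edge G (vertex W (toℕ (inject₁ i))) (vertex W (suc (toℕ i)))
    edges i = subst (λ k → Edge G (vertex W k) (vertex W (suc (toℕ i)))) (≡.sym (toℕ-inject₁ i))
                (proj₁ (step W (bound (m<n⇒m<1+n (toℕ<n i)))))
    last : Edge G (vertex W (toℕ (fromℕ K))) (vertex W 0)
    last = subst₂ (λ k v → Edge G (vertex W k) v) (≡.sym (toℕ-fromℕ K))
             (trans (cong (vertex W) (≡.sym L≡)) (closed W))
             (proj₁ (step W (bound ≤-refl)))

  segment : (W : OddClosedWalk G) (i d : ℕ) → parity d ≡ 1ℙ → i + d ≤ length W →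
            vertex W (i + d) ≡ vertex W i → OddClosedWalk G
  segment W i d odd-d i+d≤L returns = record
    { length = d
    ; vertex = λ k → vertex W (i + k)
    ; odd    = odd-d
    ; closed = trans returns (cong (vertex W) (≡.sym (+-identityʳ i)))
    ; step   = λ {k} k<d → subst (ProperEdge G (vertex W (i + k)))
                             (cong (vertex W) (≡.sym (+-suc i k)))
                             (step W (<-≤-trans (+-monoʳ-< i k<d) i+d≤L))
    }

  bypass : (W : OddClosedWalk G) (i d : ℕ) → parity d ≡ 0ℙ → i + d < length W →
           vertex W (i + d) ≡ vertex W i → OddClosedWalk G
  bypass W i d even-d i+d<L returns = record
    { length = L′
    ; vertex = vertex′
    ; odd    = trans (parity-∸-even even-d d≤L) (odd W)
    ; closed = trans (vertex′-> (m+n≤o⇒m≤o∸n (suc i) i+d<L))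
                 (trans (cong (vertex W) (m∸n+n≡m d≤L)) (trans (closed W) (≡.sym (vertex′-≤ z≤n))))
    ; step   = step′
    }
    where
    L′ = length W ∸ d
    d≤L : d ≤ length W
    d≤L = ≤-trans (m≤n+m d i) (<⇒≤ i+d<L)

    vertex′ : ℕ → V G
    vertex′ k with k ≤? i
    ... | yes _ = vertex W k
    ... | no  _ = vertex W (k + d)

    vertex′-≤ : ∀ {k} → k ≤ i → vertex′ k ≡ vertex W k
    vertex′-≤ {k} k≤i with k ≤? i
    ... | yes _   = refl
    ... | no  k≰i = contradiction k≤i k≰i

    vertex′-> : ∀ {k} → i < k → vertex′ k ≡ vertex W (k + d)
    vertex′-> {k} i<k with k ≤? i
    ... | yes k≤i = contradiction k≤i (<⇒≱ i<k)
    ... | no  _   = refl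

    step′ : ∀ {k} → k < L′ → ProperEdge G (vertex′ k) (vertex′ (suc k))
    step′ {k} k<L′ with <-cmp k i
    ... | tri< k<i _ _ = subst₂ (ProperEdge G)
                           (≡.sym (vertex′-≤ (<⇒≤ k<i))) (≡.sym (vertex′-≤ k<i))
                           (step W (<-trans k<i (≤-<-trans (m≤m+n i d) i+d<L)))
    ... | tri≈ _ refl _ = subst₂ (ProperEdge G) (trans returns (≡.sym (vertex′-≤ ≤-refl)))
                            (≡.sym (vertex′-> ≤-refl)) (step W i+d<L)
    ... | tri> _ _ i<k = subst₂ (ProperEdge G)
                           (≡.sym (vertex′-> i<k)) (≡.sym (vertex′-> (m<n⇒m<1+n i<k)))
                           (step W (subst (suc k + d ≤_) (m∸n+n≡m d≤L) (+-monoˡ-≤ d k<L′)))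

  -- Cutting at a repeated vertex splits the walk into two closed walks whose lengths
  -- add up to the original one, so one of them is odd.
  repeat⇒shorter : (W : OddClosedWalk G) → Repeat W → Σ[ W′ ∈ OddClosedWalk G ] length W′ < length W
  repeat⇒shorter W (j , j<L , i , i<j , repeats) = byParity (parity d) refl
    where
    d = j ∸ i
    i+d≡j : i + d ≡ j
    i+d≡j = m+[n∸m]≡n (<⇒≤ i<j)
    returns : vertex W (i + d) ≡ vertex W i
    returns = trans (cong (vertex W) i+d≡j) (≡.sym repeats)
    byParity : ∀ p → parity d ≡ p → Σ[ W′ ∈ OddClosedWalk G ] length W′ < length W
    byParity 1ℙ odd-d  = segment W i d odd-d (subst (_≤ length W) (≡.sym i+d≡j) (<⇒≤ j<L)) returns
                       , ≤-<-trans (m∸n≤m j i) j<L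
    byParity 0ℙ even-d = bypass W i d even-d (subst (_< length W) (≡.sym i+d≡j) j<L) returns
                       , ∸-monoʳ-< (m<n⇒0<n∸m i<j) (≤-trans (m∸n≤m j i) (<⇒≤ j<L))

  OddClosedWalk⇒OddCycle : OddClosedWalk G → OddCycle G
  OddClosedWalk⇒OddCycle W = <-rec Shortening shorten (length W) W refl
    where
    Shortening : ℕ → Set
    Shortening L = (W : OddClosedWalk G) → length W ≡ L → OddCycle G
    shorten : ∀ L → (∀ {L′} → L′ < L → Shortening L′) → Shortening L
    shorten L rec W refl with repeat? W
    ... | yes r = let (W′ , shorter) = repeat⇒shorter W r in rec shorter W′ refl
    ... | no ¬r = noRepeat⇒OddCycle W ¬r

ProperColouring⇒InCo : ∀ {G col} → ProperColouring G col → InCo G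
ProperColouring⇒InCo {G} proper = properColouring⇒noOddClosedWalk proper ∘ OddCycle⇒OddClosedWalk {G}

strictHom⇒InCo : ∀ {G H ξ} → IsStrictHom G H ξ → InCo H → InCo G
strictHom⇒InCo {G} {H} ξ-strict InCo-H =
  InCo-H ∘ OddClosedWalk⇒OddCycle ∘ OddClosedWalk-map {G} {H} ξ-strict ∘ OddCycle⇒OddClosedWalk

module _ (R : Graph) where

  EVo-≡ : {𝔞 𝔟 : EVo R} → comps R 𝔞 ≡ comps R 𝔟 → 𝔞 ≡ 𝔟
  EVo-≡ {v , D , t} {.v , .D , t′} refl = cong (λ t → v , D , t) (T-irrelevant t t′)

  _≟EVo_ : DecidableEquality (EVo R)
  𝔞 ≟EVo 𝔟 = map′ EVo-≡ (cong (comps R))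
               (Product.≡-dec _≟_ (Vec.≡-dec Bool._≟_) (comps R 𝔞) (comps R 𝔟))

  snd₂⊆N : (𝔞 : EVo R) → snd₂ R 𝔞 ⊆ N R (fst₁ R 𝔞)
  snd₂⊆N 𝔞 = toWitness (proj₂ (proj₂ 𝔞))

  fst₁∉snd₂ : (𝔞 : EVo R) → fst₁ R 𝔞 ∉ snd₂ R 𝔞
  fst₁∉snd₂ 𝔞 a∈ = proj₂ (to (∈-N R) (snd₂⊆N 𝔞 a∈)) refl

-- Bipartite test graphs

module TestGraph (R : Graph) {a b : V R} {A B : Subset (suc (n R))}
                 (A⊆N : A ⊆ N R a) (B⊆N : B ⊆ N R b)
                 (loop : Bool) (loop⇒Edge : T loop → Edge R a a) where

  M : ℕ
  M = suc (n R)

  Side : Set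
  Side = V R ⊎ V R

  Link : V R → V R → Set
  Link p q = (p ≡ a × q ∈ A) ⊎ (q ≡ b × p ∈ B)

  link? : ∀ p q → Dec (Link p q)
  link? p q = (p ≟ a ×-dec q ∈? A) ⊎-dec (q ≟ b ×-dec p ∈? B)

  adj′ : Side → Side → Bool
  adj′ (inj₁ p) (inj₁ q) = loop ∧ (⌊ p ≟ a ⌋ ∧ ⌊ q ≟ a ⌋)
  adj′ (inj₁ p) (inj₂ q) = ⌊ link? p q ⌋
  adj′ (inj₂ q) (inj₁ p) = ⌊ link? p q ⌋
  adj′ (inj₂ _) (inj₂ _) = false

  adj′-sym : ∀ s t → adj′ s t ≡ adj′ t s
  adj′-sym (inj₁ p) (inj₁ q) = cong (loop ∧_) (∧-comm ⌊ p ≟ a ⌋ ⌊ q ≟ a ⌋)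
  adj′-sym (inj₁ _) (inj₂ _) = refl
  adj′-sym (inj₂ _) (inj₁ _) = refl
  adj′-sym (inj₂ _) (inj₂ _) = refl

  G : Graph
  G = record
    { n   = n R + M
    ; adj = λ x y → adj′ (splitAt M x) (splitAt M y)
    ; sym = λ x y → adj′-sym (splitAt M x) (splitAt M y)
    }

  ⌜_⌝ : Side → V G
  ⌜_⌝ = join M M

  ⌜⌝-injective : ∀ {s t} → ⌜ s ⌝ ≡ ⌜ t ⌝ → s ≡ t
  ⌜⌝-injective {s} {t} eq =
    trans (≡.sym (splitAt-join M M s)) (trans (cong (splitAt M) eq) (splitAt-join M M t))

  ξ : V G → V R
  ξ = reduce ∘ splitAt M

  ξ-⌜⌝ : ∀ s → ξ ⌜ s ⌝ ≡ reduce s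
  ξ-⌜⌝ s = cong reduce (splitAt-join M M s)

  Edge-⌜⌝ : ∀ s t → T (adj′ s t) → Edge G ⌜ s ⌝ ⌜ t ⌝
  Edge-⌜⌝ s t = subst T (≡.sym (cong₂ adj′ (splitAt-join M M s) (splitAt-join M M t)))

  ≢-splitAt : ∀ {x y : V G} → x ≢ y → splitAt M x ≢ splitAt M y
  ≢-splitAt {x} {y} x≢y eq = x≢y (begin
    x                       ≡⟨ join-splitAt M M x ⟨
    ⌜ splitAt M x ⌝         ≡⟨ cong ⌜_⌝ eq ⟩
    ⌜ splitAt M y ⌝         ≡⟨ join-splitAt M M y ⟩
    y                       ∎)
    where open ≡.≡-Reasoning

  loop-at-a : ∀ {p q} → T (adj′ (inj₁ p) (inj₁ q)) → T loop × p ≡ a × q ≡ a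
  loop-at-a {p} {q} e =
    let (l , e′) = to T-∧ e ; (p≟a , q≟a) = to (T-∧ {⌊ p ≟ a ⌋}) e′ in
    l , toWitness p≟a , toWitness q≟a

  Link⇒ProperEdge : ∀ {p q} → Link p q → ProperEdge R p q
  Link⇒ProperEdge (inj₁ (refl , q∈A)) = to (∈-N R) (A⊆N q∈A)
  Link⇒ProperEdge (inj₂ (refl , p∈B)) = to (∈-N R) (∈-N-sym R (B⊆N p∈B))

  adj′-hom : ∀ s t → T (adj′ s t) → Edge R (reduce s) (reduce t)
  adj′-hom (inj₁ p) (inj₁ q) e with loop-at-a {p} {q} e
  ... | l , refl , refl = loop⇒Edge l
  adj′-hom (inj₁ p) (inj₂ q) e = proj₁ (Link⇒ProperEdge (toWitness e))
  adj′-hom (inj₂ q) (inj₁ p) e = proj₁ (ProperEdge-sym R (Link⇒ProperEdge (toWitness e)))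

  adj′-strict : ∀ s t → s ≢ t → T (adj′ s t) → reduce s ≢ reduce t
  adj′-strict (inj₁ p) (inj₁ q) s≢t e with loop-at-a {p} {q} e
  ... | _ , refl , refl = contradiction refl s≢t
  adj′-strict (inj₁ p) (inj₂ q) _ e = proj₂ (Link⇒ProperEdge (toWitness e))
  adj′-strict (inj₂ q) (inj₁ p) _ e = proj₂ (ProperEdge-sym R (Link⇒ProperEdge (toWitness e)))

  ξ-strict : IsStrictHom G R ξ
  ξ-strict = (λ x y → adj′-hom (splitAt M x) (splitAt M y))
           , (λ x y x≢y → adj′-strict (splitAt M x) (splitAt M y) (≢-splitAt x≢y))

  side : Side → Parity
  side = [ const 0ℙ , const 1ℙ ]′

  adj′-crosses : ∀ s t → s ≢ t → T (adj′ s t) → side s ≢ side t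
  adj′-crosses (inj₁ p) (inj₁ q) s≢t e with loop-at-a {p} {q} e
  ... | _ , refl , refl = contradiction refl s≢t
  adj′-crosses (inj₁ _) (inj₂ _) _ _ ()
  adj′-crosses (inj₂ _) (inj₁ _) _ _ ()

  G-InCo : InCo G
  G-InCo = ProperColouring⇒InCo {G} {side ∘ splitAt M}
    λ {x} {y} (e , x≢y) → adj′-crosses (splitAt M x) (splitAt M y) (≢-splitAt x≢y) e

  ∈-N-⌜⌝ : ∀ {s u} → u ∈ N G ⌜ s ⌝ → s ≢ splitAt M u × T (adj′ s (splitAt M u))
  ∈-N-⌜⌝ {s} {u} u∈ =
    let (e , ne) = to (∈-N G) u∈ in
    (λ eq → ne (trans (cong ⌜_⌝ eq) (join-splitAt M M u))) ,
    subst (λ s′ → T (adj′ s′ (splitAt M u))) (splitAt-join M M s) e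

  ⌜⌝-∈-N : ∀ s t → s ≢ t → T (adj′ s t) → ⌜ t ⌝ ∈ N G ⌜ s ⌝
  ⌜⌝-∈-N s t s≢t e = from (∈-N G) (Edge-⌜⌝ s t e , s≢t ∘ ⌜⌝-injective)

  left right : V G
  left  = ⌜ inj₁ a ⌝
  right = ⌜ inj₂ b ⌝

  ξ-left : ξ left ≡ a
  ξ-left = ξ-⌜⌝ (inj₁ a)

  ξ-right : ξ right ≡ b
  ξ-right = ξ-⌜⌝ (inj₂ b)

  left-right : b ∈ A → Edge G left right
  left-right b∈A = Edge-⌜⌝ (inj₁ a) (inj₂ b) (fromWitness (inj₁ (refl , b∈A)))

  left-loop : T loop → Edge G left left
  left-loop l = Edge-⌜⌝ (inj₁ a) (inj₁ a)
    (from (T-∧ {loop}) (l , from (T-∧ {⌊ a ≟ a ⌋}) (fromWitness refl , fromWitness refl)))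

  neighbour-of-a : (a ∈ B → b ∈ A) → ∀ t → inj₁ a ≢ t → T (adj′ (inj₁ a) t) → reduce t ∈ A
  neighbour-of-a _ (inj₁ p) a≢p e with loop-at-a {a} {p} e
  ... | _ , _ , refl = contradiction refl a≢p
  neighbour-of-a a∈B⇒b∈A (inj₂ q) _ e with toWitness e
  ... | inj₁ (_ , q∈A)    = q∈A
  ... | inj₂ (refl , a∈B) = a∈B⇒b∈A a∈B

  neighbour-of-b : (b ∈ A → a ∈ B) → ∀ t → inj₂ b ≢ t → T (adj′ (inj₂ b) t) → reduce t ∈ B
  neighbour-of-b b∈A⇒a∈B (inj₁ p) _ e with toWitness e
  ... | inj₁ (refl , b∈A) = b∈A⇒a∈B b∈A
  ... | inj₂ (_ , p∈B)    = p∈B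

  img-left : (a ∈ B → b ∈ A) → img G R ξ (N G left) ≡ A
  img-left a∈B⇒b∈A = img-N-≡ G R ξ left
    (λ u∈ → let (ne , e) = ∈-N-⌜⌝ u∈ in neighbour-of-a a∈B⇒b∈A _ ne e)
    (λ {r} r∈A → ⌜ inj₂ r ⌝ ,
                 ⌜⌝-∈-N (inj₁ a) (inj₂ r) (λ ()) (fromWitness (inj₁ (refl , r∈A))) ,
                 ξ-⌜⌝ (inj₂ r))

  img-right : (b ∈ A → a ∈ B) → img G R ξ (N G right) ≡ B
  img-right b∈A⇒a∈B = img-N-≡ G R ξ right
    (λ u∈ → let (ne , e) = ∈-N-⌜⌝ u∈ in neighbour-of-b b∈A⇒a∈B _ ne e)
    (λ {r} r∈B → ⌜ inj₁ r ⌝ ,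
                 ⌜⌝-∈-N (inj₂ b) (inj₁ r) (λ ()) (fromWitness (inj₂ (refl , r∈B))) ,
                 ξ-⌜⌝ (inj₁ r))

-- Edges of 𝓔(R)

module EVEdges (P : Graph → Set) (InCo⇒P : ∀ G → InCo G → P G) (R : Graph) where

  CrossMember : EVo R → EVo R → Set
  CrossMember 𝔞 𝔟 = fst₁ R 𝔞 ∈ snd₂ R 𝔟 × fst₁ R 𝔟 ∈ snd₂ R 𝔞

  CrossMember⇒≢ : ∀ {𝔞 𝔟} → CrossMember 𝔞 𝔟 → 𝔞 ≢ 𝔟
  CrossMember⇒≢ {𝔞} (a₁∈a₂ , _) refl = fst₁∉snd₂ R 𝔞 a₁∈a₂

  EVEdge⇒CrossMember : ∀ {𝔞 𝔟} → 𝔞 ≢ 𝔟 → EVEdge P R 𝔞 𝔟 → CrossMember 𝔞 𝔟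
  EVEdge⇒CrossMember 𝔞≢𝔟 (G , _ , ξ , _ , v , w , e , 𝔞≡α[v] , 𝔟≡α[w]) with v ≟ w
  ... | yes refl = contradiction (EVo-≡ R (trans 𝔞≡α[v] (≡.sym 𝔟≡α[w]))) 𝔞≢𝔟
  ... | no  v≢w  =
    subst₂ _∈_ (≡.sym (cong proj₁ 𝔞≡α[v])) (≡.sym (cong proj₂ 𝔟≡α[w]))
      (from (∈-img G R {ξ}) (v , ∈-N-sym G w∈N[v] , refl)) ,
    subst₂ _∈_ (≡.sym (cong proj₁ 𝔟≡α[w])) (≡.sym (cong proj₂ 𝔞≡α[v]))
      (from (∈-img G R {ξ}) (w , w∈N[v] , refl))
    where
    w∈N[v] : w ∈ N G v
    w∈N[v] = from (∈-N G) (e , v≢w)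

  CrossMember⇒EVEdge : ∀ {𝔞 𝔟} → CrossMember 𝔞 𝔟 → EVEdge P R 𝔞 𝔟
  CrossMember⇒EVEdge {𝔞} {𝔟} (a₁∈b₂ , b₁∈a₂) =
    G , InCo⇒P G G-InCo , ξ , ξ-strict , left , right , left-right b₁∈a₂ ,
    cong₂ _,_ (≡.sym ξ-left) (≡.sym (img-left (const b₁∈a₂))) ,
    cong₂ _,_ (≡.sym ξ-right) (≡.sym (img-right (const a₁∈b₂)))
    where open TestGraph R (snd₂⊆N R 𝔞) (snd₂⊆N R 𝔟) false (λ ())

  properEVEdge⇔CrossMember : ∀ 𝔞 𝔟 → (𝔞 ≢ 𝔟 × EVEdge P R 𝔞 𝔟) ⇔ CrossMember 𝔞 𝔟
  properEVEdge⇔CrossMember 𝔞 𝔟 = mk⇔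
    (λ (𝔞≢𝔟 , e) → EVEdge⇒CrossMember {𝔞} {𝔟} 𝔞≢𝔟 e)
    (λ cross → CrossMember⇒≢ {𝔞} {𝔟} cross , CrossMember⇒EVEdge {𝔞} {𝔟} cross)

  EVEdge-loop⇒Edge : ∀ {𝔞} → EVEdge P R 𝔞 𝔞 → Edge R (fst₁ R 𝔞) (fst₁ R 𝔞)
  EVEdge-loop⇒Edge (G , _ , ξ , (hom , strict) , v , w , e , 𝔞≡α[v] , 𝔞≡α[w]) with v ≟ w
  ... | yes refl = subst₂ (Edge R) (≡.sym (cong proj₁ 𝔞≡α[v])) (≡.sym (cong proj₁ 𝔞≡α[v]))
                     (hom v v e)
  ... | no  v≢w  = contradiction (trans (≡.sym (cong proj₁ 𝔞≡α[v])) (cong proj₁ 𝔞≡α[w]))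
                     (strict v w v≢w e)

  Edge⇒EVEdge-loop : ∀ {𝔞} → Edge R (fst₁ R 𝔞) (fst₁ R 𝔞) → EVEdge P R 𝔞 𝔞
  Edge⇒EVEdge-loop {𝔞} loop =
    G , InCo⇒P G G-InCo , ξ , ξ-strict , left , left , left-loop tt , α[left] , α[left]
    where
    open TestGraph R {b = fst₁ R 𝔞} {B = ⊥} (snd₂⊆N R 𝔞) (⊥-elim ∘ ∉⊥) true (const loop)
    α[left] : comps R 𝔞 ≡ αpair G R ξ left
    α[left] = cong₂ _,_ (≡.sym ξ-left) (≡.sym (img-left (⊥-elim ∘ ∉⊥)))

  loopEVEdge⇔Edge : ∀ 𝔞 → EVEdge P R 𝔞 𝔞 ⇔ Edge R (fst₁ R 𝔞) (fst₁ R 𝔞)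
  loopEVEdge⇔Edge 𝔞 = mk⇔ (EVEdge-loop⇒Edge {𝔞}) (Edge⇒EVEdge-loop {𝔞})

-- 𝓔(R) as a finite graph

index-of-lookup : ∀ {A : Set} {xs : List A} → Unique xs →
                  ∀ i (p : List.lookup xs i ∈ₗ xs) → index p ≡ i
index-of-lookup {xs = _ ∷ _}  u       zero    (here _)  = refl
index-of-lookup {xs = _ ∷ _}  u       zero    (there p) = contradiction p (Unique[x∷xs]⇒x∉xs u)
index-of-lookup {xs = _ ∷ xs} u       (suc i) (here eq) =
  contradiction (subst (_∈ₗ xs) eq (∈-lookup i)) (Unique[x∷xs]⇒x∉xs u)
index-of-lookup {xs = _ ∷ _}  (_ ∷ u) (suc i) (there p) = cong suc (index-of-lookup u i p)

enumeration⇒↔Fin : ∀ {A : Set} → DecidableEquality A → (x₀ : A) (xs : List A) →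
                   (∀ x → x ∈ₗ xs) → Σ[ k ∈ ℕ ] Fin (suc k) ↔ A
enumeration⇒↔Fin _≟ₐ_ x₀ xs complete =
  pred (List.length ys) ,
  mk↔ₛ′ (List.lookup ys) (index ∘ ∈ys)
        (λ x → ≡.sym (lookup-index (∈ys x)))
        (λ i → index-of-lookup (deduplicate-! _≟ₐ_ (x₀ ∷ xs)) i (∈ys (List.lookup ys i)))
  where
  ys = deduplicate _≟ₐ_ (x₀ ∷ xs)
  ∈ys : ∀ x → x ∈ₗ ys
  ∈ys x = ∈-deduplicate⁺ _≟ₐ_ (there (complete x))

subsets : ∀ m → List (Subset m)
subsets zero    = [] ∷ []
subsets (suc m) = cartesianProductWith _∷_ (true ∷ false ∷ []) (subsets m)

∈-subsets : ∀ {m} (p : Subset m) → p ∈ₗ subsets m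
∈-subsets []          = here refl
∈-subsets (true  ∷ p) = ∈-cartesianProductWith⁺ _∷_ {xs = true ∷ false ∷ []} (here refl) (∈-subsets p)
∈-subsets (false ∷ p) =
  ∈-cartesianProductWith⁺ _∷_ {xs = true ∷ false ∷ []} (there (here refl)) (∈-subsets p)

module _ (R : Graph) where

  restrict : V R → Subset (suc (n R)) → EVo R
  restrict v D = v , D ∩ N R v , fromWitness (λ {x} → p∩q⊆q D (N R v) {x})

  restrict-EVo : ∀ 𝔞 → restrict (fst₁ R 𝔞) (snd₂ R 𝔞) ≡ 𝔞
  restrict-EVo 𝔞 = EVo-≡ R (cong (fst₁ R 𝔞 ,_)
    (⊆-antisym (p∩q⊆p _ _) (λ x∈ → x∈p∩q⁺ (x∈ , snd₂⊆N R 𝔞 x∈))))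

  -- abstract, so that type checking never normalises the enumeration
  abstract
    EVo↔Fin : Σ[ k ∈ ℕ ] Fin (suc k) ↔ EVo R
    EVo↔Fin = enumeration⇒↔Fin (_≟EVo_ R) (restrict zero ⊥) _ λ 𝔞 →
      subst (_∈ₗ _) (restrict-EVo 𝔞)
        (∈-cartesianProductWith⁺ restrict (∈-allFin (fst₁ R 𝔞)) (∈-subsets (snd₂ R 𝔞)))

⌊⌋-⇔ : ∀ {A B : Set} → A ⇔ B → (a? : Dec A) (b? : Dec B) → ⌊ a? ⌋ ≡ ⌊ b? ⌋
⌊⌋-⇔ A⇔B a? b? = trans (isYes≗does a?) (trans (does-⇔ A⇔B a? b?) (≡.sym (isYes≗does b?)))

module EVSystem (P : Graph → Set) (InCo⇒P : ∀ G → InCo G → P G) (R : Graph) where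

  open EVEdges P InCo⇒P R

  EVAdjacent : EVo R → EVo R → Set
  EVAdjacent 𝔞 𝔟 = CrossMember 𝔞 𝔟 ⊎ (𝔞 ≡ 𝔟 × Edge R (fst₁ R 𝔞) (fst₁ R 𝔞))

  EVAdjacent? : ∀ 𝔞 𝔟 → Dec (EVAdjacent 𝔞 𝔟)
  EVAdjacent? 𝔞 𝔟 = (fst₁ R 𝔞 ∈? snd₂ R 𝔟 ×-dec fst₁ R 𝔟 ∈? snd₂ R 𝔞)
                    ⊎-dec (_≟EVo_ R 𝔞 𝔟 ×-dec T? (adj R (fst₁ R 𝔞) (fst₁ R 𝔞)))

  EVAdjacent-sym : ∀ {𝔞 𝔟} → EVAdjacent 𝔞 𝔟 → EVAdjacent 𝔟 𝔞
  EVAdjacent-sym (inj₁ (a₁∈b₂ , b₁∈a₂)) = inj₁ (b₁∈a₂ , a₁∈b₂)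
  EVAdjacent-sym (inj₂ (refl , loop))   = inj₂ (refl , loop)

  EVEdge⇔EVAdjacent : ∀ 𝔞 𝔟 → EVEdge P R 𝔞 𝔟 ⇔ EVAdjacent 𝔞 𝔟
  EVEdge⇔EVAdjacent 𝔞 𝔟 with _≟EVo_ R 𝔞 𝔟
  ... | yes refl = mk⇔ (λ e → inj₂ (refl , to (loopEVEdge⇔Edge 𝔞) e)) λ where
    (inj₁ (a₁∈a₂ , _)) → contradiction a₁∈a₂ (fst₁∉snd₂ R 𝔞)
    (inj₂ (_ , loop))  → from (loopEVEdge⇔Edge 𝔞) loop
  ... | no 𝔞≢𝔟   = mk⇔ (λ e → inj₁ (to (properEVEdge⇔CrossMember 𝔞 𝔟) (𝔞≢𝔟 , e))) λ where
    (inj₁ cross)    → CrossMember⇒EVEdge {𝔞} {𝔟} cross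
    (inj₂ (𝔞≡𝔟 , _)) → contradiction 𝔞≡𝔟 𝔞≢𝔟

  k : ℕ
  k = proj₁ (EVo↔Fin R)

  iso : Fin (suc k) ↔ EVo R
  iso = proj₂ (EVo↔Fin R)

  toEVo : Fin (suc k) → EVo R
  toEVo = Inverse.to iso

  toEVo-injective : ∀ {x y} → toEVo x ≡ toEVo y → x ≡ y
  toEVo-injective = Injection.injective (↔⇒↣ iso)

  H : Graph
  H = record
    { n   = k
    ; adj = λ x y → ⌊ EVAdjacent? (toEVo x) (toEVo y) ⌋
    ; sym = λ x y → ⌊⌋-⇔ (mk⇔ EVAdjacent-sym EVAdjacent-sym)
                          (EVAdjacent? (toEVo x) (toEVo y)) (EVAdjacent? (toEVo y) (toEVo x))
    }

  ξ : V H → V R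
  ξ = φ R ∘ toEVo

  Edge-H : ∀ {x y} → Edge H x y ⇔ EVAdjacent (toEVo x) (toEVo y)
  Edge-H = mk⇔ toWitness fromWitness

  ξ-strict : IsStrictHom H R ξ
  ξ-strict = hom , strict
    where
    hom : ∀ x y → Edge H x y → Edge R (ξ x) (ξ y)
    hom x y e with to Edge-H e
    ... | inj₁ (_ , y₁∈x₂) = proj₁ (to (∈-N R) (snd₂⊆N R (toEVo x) y₁∈x₂))
    ... | inj₂ (x≡y , loop) = subst (λ 𝔟 → Edge R (ξ x) (fst₁ R 𝔟)) x≡y loop
    strict : ∀ x y → x ≢ y → Edge H x y → ξ x ≢ ξ y
    strict x y x≢y e with to Edge-H e
    ... | inj₁ (_ , y₁∈x₂) = proj₂ (to (∈-N R) (snd₂⊆N R (toEVo x) y₁∈x₂))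
    ... | inj₂ (x≡y , _)   = contradiction (toEVo-injective x≡y) x≢y

  partner : (𝔞 : EVo R) {r : V R} → r ∈ snd₂ R 𝔞 → EVo R
  partner 𝔞 {r} r∈a₂ = r , ⁅ fst₁ R 𝔞 ⁆ , fromWitness (λ {y} → ⁅a₁⁆⊆N[r] {y})
    where
    ⁅a₁⁆⊆N[r] : ⁅ fst₁ R 𝔞 ⁆ ⊆ N R r
    ⁅a₁⁆⊆N[r] y∈ = subst (_∈ N R r) (≡.sym (x∈⁅y⁆⇒x≡y _ y∈)) (∈-N-sym R (snd₂⊆N R 𝔞 r∈a₂))

  partner-CrossMember : ∀ 𝔞 {r} (r∈a₂ : r ∈ snd₂ R 𝔞) → CrossMember 𝔞 (partner 𝔞 r∈a₂)
  partner-CrossMember 𝔞 r∈a₂ = x∈⁅x⁆ (fst₁ R 𝔞) , r∈a₂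

  img-ξ : ∀ x → img H R ξ (N H x) ≡ snd₂ R (toEVo x)
  img-ξ x = img-N-≡ H R ξ x img⊆ ⊆img
    where
    img⊆ : ∀ {u} → u ∈ N H x → ξ u ∈ snd₂ R (toEVo x)
    img⊆ u∈ with to (∈-N H) u∈
    ... | e , x≢u with to Edge-H e
    ... | inj₁ (_ , u₁∈x₂) = u₁∈x₂
    ... | inj₂ (x≡u , _)   = contradiction (toEVo-injective x≡u) x≢u
    ⊆img : ∀ {r} → r ∈ snd₂ R (toEVo x) → ∃[ u ] u ∈ N H x × ξ u ≡ r
    ⊆img r∈ = u , from (∈-N H) (from Edge-H (inj₁ cross) , x≢u) , cong (fst₁ R) toEVo-u
      where
      u = Inverse.from iso (partner (toEVo x) r∈)
      toEVo-u : toEVo u ≡ partner (toEVo x) r∈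
      toEVo-u = Inverse.strictlyInverseˡ iso (partner (toEVo x) r∈)
      cross : CrossMember (toEVo x) (toEVo u)
      cross = subst (CrossMember (toEVo x)) (≡.sym toEVo-u) (partner-CrossMember (toEVo x) r∈)
      x≢u : x ≢ u
      x≢u = CrossMember⇒≢ cross ∘ cong toEVo

  ERD-of : P H → ERD P R
  ERD-of P-H = record
    { H     = H
    ; inU'  = P-H
    ; iso   = iso
    ; edges = λ x y → ⇔-sym (EVEdge⇔EVAdjacent (toEVo x) (toEVo y)) ⇔-∘ Edge-H
    }

  AID-of : P H → AID P R
  AID-of P-H = ERD-of P-H , ξ-strict , λ x → cong (ξ x ,_) (img-ξ x)

  H-InCo : InCo R → InCo H
  H-InCo = strictHom⇒InCo {H} {R} ξ-strict

proposition6 : (P : Graph → Set) → IsoInvariant P → (∀ G → InCo G → P G) →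
    (R : Graph) →
    ((𝔞 𝔟 : EVo R) →
        ((𝔞 ≢ 𝔟 × EVEdge P R 𝔞 𝔟) ⇔ (fst₁ R 𝔞 ∈ snd₂ R 𝔟 × fst₁ R 𝔟 ∈ snd₂ R 𝔞))) ×
    ((𝔞 : EVo R) → EVEdge P R 𝔞 𝔞 ⇔ Edge R (fst₁ R 𝔞) (fst₁ R 𝔞)) ×
    ((∀ G → P G) → ERD P R × AID P R) ×
    (InCo R → ERD P R × AID P R)
proposition6 P _ InCo⇒P R =
  properEVEdge⇔CrossMember ,
  loopEVEdge⇔Edge ,
  (λ P-all → ERD-of (P-all H) , AID-of (P-all H)) ,
  (λ R-InCo → ERD-of (InCo⇒P H (H-InCo R-InCo)) , AID-of (InCo⇒P H (H-InCo R-InCo)))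
  where
  open EVEdges P InCo⇒P R
  open EVSystem P InCo⇒P R
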